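{- Let $G$ be a connected graph of order $n$. If $G$ has an induced subgraph isomorphic to the cycle $C_5$, or to $S_{2,3}$, or to $K_1+C_4$, then $pd_s(G)\le n-2$.
   Context: Graphs are finite, simple, connected; $d_G$ is shortest-path distance, $d_G(x,W)=\min\{d_G(x,w):w\in W\}$. A set $W$ strongly resolves different vertices $x,y\notin W$ if $d_G(x,W)=d_G(x,y)+d_G(y,W)$ or $d_G(y,W)=d_G(y,x)+d_G(x,W)$. A vertex partition $\Pi$ is a strong resolving partition if every two different vertices in the same set of $\Pi$ are strongly resolved by some set of $\Pi$; $pd_s(G)$ is the minimum cardinality of such a partition. $S_{2,3}$ is the graph consisting of two vertices $x,z$ and three further vertices $y_1,y_2,y_3$ each adjacent to both $x$ and $z$ and to nothing else (three internally disjoint $x$–$z$ paths of length $2$). $K_1+C_4$ is the join of a single vertex with a $4$-cycle (the wheel with four rim vertices). -}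

module Defs where

open import Data.Nat using (ℕ; zero; suc; _+_; _≤_)
open import Data.Fin using (Fin; zero; suc)
open import Data.Bool using (Bool; true; false; _∧_; _∨_; if_then_else_)
open import Data.Bool.ListAction using (any)
open import Data.List using () renaming (allFin to allFinL)
open import Data.Fin using (_≟_)
open import Relation.Nullary.Decidable using (⌊_⌋)
open import Data.Product using (Σ; ∃; _×_; _,_)
open import Data.Sum using (_⊎_)
open import Relation.Binary.PropositionalEquality using (_≡_; _≢_)
open import Relation.Nullary using (¬_)
open import Function.Definitions using (Injective)

record Graph (n : ℕ) : Set where
  field
    adj   : Fin n → Fin n → Bool
    sym   : ∀ x y → adj x y ≡ adj y x
    loopless : ∀ x → adj x x ≡ false
open Graph public

module _ {n : ℕ} (G : Graph n) where

  reach : ℕ → Fin n → Fin n → Bool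
  reach zero    x y = ⌊ x ≟ y ⌋
  reach (suc k) x y = reach k x y ∨ any (λ z → reach k x z ∧ adj G z y) (allFinL n)

  Connected : Set
  Connected = ∀ x y → Σ ℕ λ k → reach k x y ≡ true

  -- shortest-path distance: the least k (searched among 0 .. n) with reach k x y.
  -- For a connected graph on n vertices this is the usual distance d_G(x,y).
  private
    search : Fin n → Fin n → ℕ → ℕ → ℕ
    search x y k zero    = k
    search x y k (suc f) = if reach k x y then k else search x y (suc k) f

  dist : Fin n → Fin n → ℕ
  dist x y = search x y 0 n

  -- A partition with k classes: a surjective class-assignment Fin n → Fin k.
  -- d_G(x, W_j) = m, where W_j is the class with index j (m is the minimum).
  DistToClass : {k : ℕ} → (Fin n → Fin k) → Fin n → Fin k → ℕ → Set
  DistToClass c x j m =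
    (Σ (Fin n) λ w → (c w ≡ j) × (dist x w ≡ m)) ×
    (∀ w → c w ≡ j → m ≤ dist x w)

  StronglyResolves : {k : ℕ} → (Fin n → Fin k) → Fin k → Fin n → Fin n → Set
  StronglyResolves c j x y =
    (c x ≢ j) × (c y ≢ j) ×
    Σ ℕ λ a → Σ ℕ λ b → DistToClass c x j a × DistToClass c y j b ×
      ((a ≡ dist x y + b) ⊎ (b ≡ dist y x + a))

  IsStrongResolvingPartition : {k : ℕ} → (Fin n → Fin k) → Set
  IsStrongResolvingPartition {k} c =
    (∀ j → Σ (Fin n) λ v → c v ≡ j) ×
    (∀ x y → x ≢ y → c x ≡ c y → Σ (Fin k) λ j → StronglyResolves c j x y)

  PdsAtMost : ℕ → Set
  PdsAtMost m = Σ ℕ λ k → (k ≤ m) × Σ (Fin n → Fin k) λ c → IsStrongResolvingPartition c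

HasInducedCopy : {n m : ℕ} → Graph n → (Fin m → Fin m → Bool) → Set
HasInducedCopy {n} {m} G h =
  Σ (Fin m → Fin n) λ f → Injective _≡_ _≡_ f × (∀ i j → adj G (f i) (f j) ≡ h i j)

-- C5: 0-1-2-3-4-0
C5 : Fin 5 → Fin 5 → Bool
C5 zero (suc zero) = true
C5 (suc zero) (suc (suc zero)) = true
C5 (suc (suc zero)) (suc (suc (suc zero))) = true
C5 (suc (suc (suc zero))) (suc (suc (suc (suc zero)))) = true
C5 (suc (suc (suc (suc zero)))) zero = true
C5 (suc zero) zero = true
C5 (suc (suc zero)) (suc zero) = true
C5 (suc (suc (suc zero))) (suc (suc zero)) = true
C5 (suc (suc (suc (suc zero)))) (suc (suc (suc zero))) = true
C5 zero (suc (suc (suc (suc zero)))) = true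
C5 _ _ = false

-- S_{2,3}: x = 0, z = 1, y1,y2,y3 = 2,3,4; each y_i adjacent to exactly x and z
S23 : Fin 5 → Fin 5 → Bool
S23 zero (suc (suc _)) = true
S23 (suc zero) (suc (suc _)) = true
S23 (suc (suc _)) zero = true
S23 (suc (suc _)) (suc zero) = true
S23 _ _ = false

-- K1 + C4: hub 0 adjacent to all of 1,2,3,4; rim cycle 1-2-3-4-1
K1+C4 : Fin 5 → Fin 5 → Bool
K1+C4 zero (suc _) = true
K1+C4 (suc _) zero = true
K1+C4 (suc zero) (suc (suc zero)) = true
K1+C4 (suc (suc zero)) (suc zero) = true
K1+C4 (suc (suc zero)) (suc (suc (suc zero))) = true
K1+C4 (suc (suc (suc zero))) (suc (suc zero)) = true
K1+C4 (suc (suc (suc zero))) (suc (suc (suc (suc zero)))) = true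
K1+C4 (suc (suc (suc (suc zero)))) (suc (suc (suc zero))) = true
K1+C4 (suc (suc (suc (suc zero)))) (suc zero) = true
K1+C4 (suc zero) (suc (suc (suc (suc zero)))) = true
K1+C4 _ _ = false

module Submission where

-- On the five vertices of an induced C₅, S₂,₃ or K₁+C₄ we
-- find two pairs of vertices (or one triple) to merge into classes,
-- keeping every other vertex of G as a singleton class; this gives a
-- partition with n − 2 classes.  Every two vertices x, y that share a
-- class are adjacent, and some singleton class {w} is adjacent to x but
-- not to y, so that y – x – w is a geodesic:
--   d(y,w) = 2 = d(y,x) + d(x,w),
-- i.e. {w} strongly resolves x and y.

open import Defs hiding (sym)
open import Data.Nat using (ℕ; suc; _+_; _∸_; _≤_; s≤s)
open import Data.Nat.Properties using (≤-refl; ≤-reflexive)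
open import Data.Fin using (Fin; _≟_; punchOut; punchIn; #_)
open import Data.Fin.Properties
  using (punchOut-injective; punchOut-cong; punchOut-punchIn; punchInᵢ≢i; injective⇒≤)
open import Data.Bool using (Bool; true; false; _∧_; _∨_; if_then_else_)
open import Data.Bool.Properties using (∨-zeroʳ; T-≡)
open import Data.Bool.ListAction using (any)
open import Data.List using (List; []; _∷_) renaming (allFin to allFinL)
open import Data.List.Membership.Propositional using (_∈_; lose)
open import Data.List.Membership.Propositional.Properties using (∈-allFin)
open import Data.List.Relation.Unary.Any.Properties using (any⁺)
open import Data.Product using (Σ; _×_; _,_; proj₁; proj₂)
open import Data.Sum using (_⊎_; inj₁; inj₂; map₂)
open import Data.Empty using (⊥-elim)
open import Function using (_∘_)
open import Function.Bundles using (Equivalence)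
open import Relation.Nullary.Decidable using (yes; no)
open import Relation.Binary.PropositionalEquality
open import Relation.Nullary using (¬_)

any-witness : ∀ {A : Set} (p : A → Bool) (xs : List A) {z : A} →
              z ∈ xs → p z ≡ true → any p xs ≡ true
any-witness p xs z∈xs pz =
  Equivalence.to T-≡ (any⁺ p (lose z∈xs (Equivalence.from T-≡ pz)))

any-none : ∀ {A : Set} (p : A → Bool) (xs : List A) →
           (∀ z → p z ≡ false) → any p xs ≡ false
any-none p []       none = refl
any-none p (x ∷ xs) none rewrite none x = any-none p xs none

module Walks {n : ℕ} (G : Graph n) where

  reach0-refl : ∀ x → reach G 0 x x ≡ true
  reach0-refl x with x ≟ x
  ... | yes _  = refl
  ... | no x≢x = ⊥-elim (x≢x refl)

  reach0-distinct : ∀ {x y} → x ≢ y → reach G 0 x y ≡ false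
  reach0-distinct {x} {y} x≢y with x ≟ y
  ... | yes x≡y = ⊥-elim (x≢y x≡y)
  ... | no _    = refl

  reach-step : ∀ k x m y → reach G k x m ≡ true → adj G m y ≡ true →
               reach G (suc k) x y ≡ true
  reach-step k x m y walk edge =
    trans (cong (reach G k x y ∨_)
                (any-witness _ (allFinL n) (∈-allFin m)
                  (trans (cong (_∧ adj G m y) walk) edge)))
          (∨-zeroʳ _)

  reach1-adjacent : ∀ x y → adj G x y ≡ true → reach G 1 x y ≡ true
  reach1-adjacent x y = reach-step 0 x x y (reach0-refl x)

  reach1-nonadjacent : ∀ x y → x ≢ y → adj G x y ≡ false → reach G 1 x y ≡ false
  reach1-nonadjacent x y x≢y nonadj
    rewrite reach0-distinct x≢y = any-none _ (allFinL n) firstStepFails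
    where
    firstStepFails : ∀ z → (reach G 0 x z ∧ adj G z y) ≡ false
    firstStepFails z with x ≟ z
    ... | yes refl = nonadj
    ... | no _     = refl

  reach2-common : ∀ x m y → adj G x m ≡ true → adj G m y ≡ true →
                  reach G 2 x y ≡ true
  reach2-common x m y xm my = reach-step 1 x m y (reach1-adjacent x m xm) my

-- Distances 1 and 2.  On at least three vertices, `dist G x y` unfolds to
-- "if reach 0 then 0 else if reach 1 then 1 else if reach 2 then 2 else …";
-- the two lemmas below evaluate this chain when it stops at 1 or at 2.

firstHitAt1 : ∀ {Z : ℕ} {b₀ b₁ : Bool} → b₀ ≡ false → b₁ ≡ true →
              (if b₀ then 0 else (if b₁ then 1 else Z)) ≡ 1
firstHitAt1 refl refl = refl

firstHitAt2 : ∀ {Z : ℕ} {b₀ b₁ b₂ : Bool} → b₀ ≡ false → b₁ ≡ false → b₂ ≡ true →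
              (if b₀ then 0 else (if b₁ then 1 else (if b₂ then 2 else Z))) ≡ 2
firstHitAt2 refl refl refl = refl

adjacent-distinct : ∀ {n} (G : Graph n) {x y} → adj G x y ≡ true → x ≢ y
adjacent-distinct G {x} xy refl with trans (sym xy) (loopless G x)
... | ()

module Distances {n : ℕ} (G : Graph (suc (suc (suc n)))) where
  open Walks G

  dist-adjacent : ∀ x y → adj G x y ≡ true → dist G x y ≡ 1
  dist-adjacent x y xy =
    firstHitAt1 (reach0-distinct (adjacent-distinct G xy)) (reach1-adjacent x y xy)

  dist-commonNeighbour : ∀ x m y → x ≢ y → adj G x y ≡ false →
                         adj G x m ≡ true → adj G m y ≡ true → dist G x y ≡ 2
  dist-commonNeighbour x m y x≢y xy xm my =
    firstHitAt2 (reach0-distinct x≢y) (reach1-nonadjacent x y x≢y xy)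
                (reach2-common x m y xm my)

  dist-throughNeighbour : ∀ x y w → y ≢ w → adj G y x ≡ true → adj G x w ≡ true →
                          adj G y w ≡ false → dist G y w ≡ dist G y x + dist G x w
  dist-throughNeighbour x y w y≢w yx xw yw = begin
    dist G y w               ≡⟨ dist-commonNeighbour y x w y≢w yw yx xw ⟩
    2                        ≡⟨ cong₂ _+_ (sym (dist-adjacent y x yx)) (sym (dist-adjacent x w xw)) ⟩
    dist G y x + dist G x w  ∎
    where open ≡-Reasoning

Alone : ∀ {n k} → (Fin n → Fin k) → Fin n → Set
Alone c w = ∀ v → c v ≡ c w → v ≡ w

-- x ~ y, and w is adjacent to x but not to y: y – x – w is a geodesic.
Hinge : ∀ {n} → Graph n → Fin n → Fin n → Fin n → Set
Hinge G x y w = adj G x y ≡ true × adj G x w ≡ true × adj G y w ≡ false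

module _ {n k : ℕ} (G : Graph (suc (suc (suc n)))) (c : Fin (suc (suc (suc n))) → Fin k) where
  open Distances G

  -- A singleton class is at distance d(x,w) from x, so it strongly resolves
  -- x and y as soon as x, y, w lie on a geodesic with y (or x) in the middle.
  alone-resolves : ∀ {x y w} → Alone c w → x ≢ w → y ≢ w →
    (dist G x w ≡ dist G x y + dist G y w) ⊎ (dist G y w ≡ dist G y x + dist G x w) →
    StronglyResolves G c (c w) x y
  alone-resolves {x} {y} {w} alone x≢w y≢w geodesic =
    x≢w ∘ alone x , y≢w ∘ alone y , dist G x w , dist G y w ,
    nearest x , nearest y , geodesic
    where
    nearest : ∀ v → DistToClass G c v (c w) (dist G v w)
    nearest v = (w , refl , refl) , λ w′ e → ≤-reflexive (cong (dist G v) (sym (alone w′ e)))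

  hinge-resolves : ∀ {x y w} → x ≢ y → c x ≡ c y → Alone c w → Hinge G x y w →
                   StronglyResolves G c (c w) x y
  hinge-resolves {x} {y} {w} x≢y same alone (xy , xw , yw) =
    alone-resolves alone x≢w y≢w
      (inj₂ (dist-throughNeighbour x y w y≢w (trans (Graph.sym G y x) xy) xw yw))
    where
    x≢w : x ≢ w
    x≢w = adjacent-distinct G xw
    y≢w : y ≢ w
    y≢w refl = x≢y (alone x same)

  hingePartition :
    (∀ j → Σ (Fin (suc (suc (suc n)))) λ v → c v ≡ j) →
    (∀ x y → x ≢ y → c x ≡ c y →
       Σ (Fin (suc (suc (suc n)))) λ w → Alone c w × (Hinge G x y w ⊎ Hinge G y x w)) →
    IsStrongResolvingPartition G c
  hingePartition surjective hinges = surjective , resolved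
    where
    resolved : ∀ x y → x ≢ y → c x ≡ c y → Σ (Fin k) λ j → StronglyResolves G c j x y
    resolved x y x≢y same with hinges x y x≢y same
    ... | w , alone , inj₁ hxy = c w , hinge-resolves x≢y same alone hxy
    ... | w , alone , inj₂ hyx =
      c w , swap (hinge-resolves (x≢y ∘ sym) (sym same) alone hyx)
      where
      swap : StronglyResolves G c (c w) y x → StronglyResolves G c (c w) x y
      swap (cy , cx , b , a , db , da , inj₁ e) = cx , cy , a , b , da , db , inj₂ e
      swap (cy , cx , b , a , db , da , inj₂ e) = cx , cy , a , b , da , db , inj₁ e

IsPair : ∀ {A : Set} → A → A → A → A → Set
IsPair x y p q = (x ≡ p × y ≡ q) ⊎ (x ≡ q × y ≡ p)

orient : ∀ {n} (G : Graph n) {x y p q w} → IsPair x y p q → Hinge G p q w →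
         Hinge G x y w ⊎ Hinge G y x w
orient G (inj₁ (refl , refl)) h = inj₁ h
orient G (inj₂ (refl , refl)) h = inj₂ h

pullPair : ∀ {A B : Set} (g : A → B) {x y r s} →
           (∀ v → g v ≡ g r → v ≡ r) → (∀ v → g v ≡ g s → v ≡ s) →
           IsPair (g x) (g y) (g r) (g s) → IsPair x y r s
pullPair g {x} {y} atR atS (inj₁ (xr , ys)) = inj₁ (atR x xr , atS y ys)
pullPair g {x} {y} atR atS (inj₂ (xs , yr)) = inj₂ (atS x xs , atR y yr)

outsidePair : ∀ {A : Set} {v w p q : A} → w ≢ p → w ≢ q → ¬ IsPair v w p q
outsidePair w≢p w≢q (inj₁ (_ , w≡q)) = w≢q w≡q
outsidePair w≢p w≢q (inj₂ (_ , w≡p)) = w≢p w≡p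

-- Identify the value j with i and close the gap: a map Fin (suc k) → Fin k
-- whose only non-trivial fibre is {i,j}.
module Glue {k : ℕ} (i j : Fin (suc k)) (i≢j : i ≢ j) where

  -- send j to i; the result is never j, so punchOut j applies
  redirect : Fin (suc k) → Σ (Fin (suc k)) (j ≢_)
  redirect x with x ≟ j
  ... | yes _   = i , i≢j ∘ sym
  ... | no x≢j = x , x≢j ∘ sym

  glue : Fin (suc k) → Fin k
  glue x = punchOut (proj₂ (redirect x))

  redirect-fixes : ∀ x → x ≢ j → proj₁ (redirect x) ≡ x
  redirect-fixes x x≢j with x ≟ j
  ... | yes x≡j = ⊥-elim (x≢j x≡j)
  ... | no _    = refl

  redirect-fibre : ∀ x y → proj₁ (redirect x) ≡ proj₁ (redirect y) → x ≡ y ⊎ IsPair x y i j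
  redirect-fibre x y e with x ≟ j | y ≟ j
  ... | yes x≡j | yes y≡j = inj₁ (trans x≡j (sym y≡j))
  ... | yes x≡j | no _    = inj₂ (inj₂ (x≡j , sym e))
  ... | no _    | yes y≡j = inj₂ (inj₁ (e , y≡j))
  ... | no _    | no _    = inj₁ e

  glue-fibre : ∀ {x y} → glue x ≡ glue y → x ≡ y ⊎ IsPair x y i j
  glue-fibre {x} {y} e =
    redirect-fibre x y (punchOut-injective (proj₂ (redirect x)) (proj₂ (redirect y)) e)

  glue-surjective : ∀ l → Σ (Fin (suc k)) λ x → glue x ≡ l
  glue-surjective l = punchIn j l ,
    trans (punchOut-cong j (redirect-fixes (punchIn j l) (punchInᵢ≢i j l)))
          (punchOut-punchIn j)

  glue-fibreOf-i : ∀ {x} → glue x ≡ glue i → x ≡ i ⊎ x ≡ j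
  glue-fibreOf-i e with glue-fibre e
  ... | inj₁ x≡i              = inj₁ x≡i
  ... | inj₂ (inj₁ (x≡i , _)) = inj₁ x≡i
  ... | inj₂ (inj₂ (x≡j , _)) = inj₂ x≡j

  glue-injectiveAt : ∀ {z} → z ≢ i → z ≢ j → ∀ x → glue x ≡ glue z → x ≡ z
  glue-injectiveAt z≢i z≢j x e with glue-fibre e
  ... | inj₁ x≡z              = x≡z
  ... | inj₂ (inj₁ (_ , z≡j)) = ⊥-elim (z≢j z≡j)
  ... | inj₂ (inj₂ (_ , z≡i)) = ⊥-elim (z≢i z≡i)

composite-surjective : ∀ {A B C : Set} (f : A → B) (g : B → C) →
  (∀ b → Σ A λ a → f a ≡ b) → (∀ c → Σ B λ b → g b ≡ c) → ∀ c → Σ A λ a → g (f a) ≡ c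
composite-surjective f g f-onto g-onto c with g-onto c
... | b , gb≡c with f-onto b
...   | a , fa≡b = a , trans (cong g fa≡b) gb≡c

-- Merge two disjoint pairs {p,q} and {r,s}; every other vertex stays alone.
module TwoPairs {k : ℕ} (p q r s : Fin (suc (suc k))) (p≢q : p ≢ q) (r≢s : r ≢ s)
                (r≢p : r ≢ p) (r≢q : r ≢ q) (s≢p : s ≢ p) (s≢q : s ≢ q) where

  module G₁ = Glue p q p≢q

  glue₁-r≢s : G₁.glue r ≢ G₁.glue s
  glue₁-r≢s e = r≢s (G₁.glue-injectiveAt s≢p s≢q r e)

  module G₂ = Glue (G₁.glue r) (G₁.glue s) glue₁-r≢s

  collapse : Fin (suc (suc k)) → Fin k
  collapse = G₂.glue ∘ G₁.glue

  collapse-surjective : ∀ l → Σ (Fin (suc (suc k))) λ v → collapse v ≡ l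
  collapse-surjective =
    composite-surjective G₁.glue G₂.glue G₁.glue-surjective G₂.glue-surjective

  collapse-fibre : ∀ {x y} → collapse x ≡ collapse y →
                   x ≡ y ⊎ IsPair x y p q ⊎ IsPair x y r s
  collapse-fibre e with G₂.glue-fibre e
  ... | inj₁ e₁ = map₂ inj₁ (G₁.glue-fibre e₁)
  ... | inj₂ rs = inj₂ (inj₂ (pullPair G₁.glue (G₁.glue-injectiveAt r≢p r≢q)
                                                (G₁.glue-injectiveAt s≢p s≢q) rs))

  collapse-alone : ∀ {w} → w ≢ p → w ≢ q → w ≢ r → w ≢ s → Alone collapse w
  collapse-alone w≢p w≢q w≢r w≢s v e with collapse-fibre e
  ... | inj₁ v≡w       = v≡w
  ... | inj₂ (inj₁ pq) = ⊥-elim (outsidePair w≢p w≢q pq)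
  ... | inj₂ (inj₂ rs) = ⊥-elim (outsidePair w≢r w≢s rs)

-- Merge the three vertices h, b, a into one class; every other vertex stays alone.
module Triple {k : ℕ} (h b a : Fin (suc (suc k))) (b≢a : b ≢ a) (h≢b : h ≢ b) (h≢a : h ≢ a) where

  module G₁ = Glue b a b≢a

  glue₁-h≢b : G₁.glue h ≢ G₁.glue b
  glue₁-h≢b e = h≢b (sym (G₁.glue-injectiveAt h≢b h≢a b (sym e)))

  module G₂ = Glue (G₁.glue h) (G₁.glue b) glue₁-h≢b

  collapse : Fin (suc (suc k)) → Fin k
  collapse = G₂.glue ∘ G₁.glue

  collapse-surjective : ∀ l → Σ (Fin (suc (suc k))) λ v → collapse v ≡ l
  collapse-surjective =
    composite-surjective G₁.glue G₂.glue G₁.glue-surjective G₂.glue-surjective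

  hubPair : ∀ {x y} → x ≡ h → y ≡ b ⊎ y ≡ a → IsPair x y h b ⊎ IsPair x y h a
  hubPair x≡h (inj₁ y≡b) = inj₁ (inj₁ (x≡h , y≡b))
  hubPair x≡h (inj₂ y≡a) = inj₂ (inj₁ (x≡h , y≡a))

  swapPairs : ∀ {x y} → IsPair y x h b ⊎ IsPair y x h a → IsPair x y h b ⊎ IsPair x y h a
  swapPairs (inj₁ (inj₁ (y≡h , x≡b))) = inj₁ (inj₂ (x≡b , y≡h))
  swapPairs (inj₁ (inj₂ (y≡b , x≡h))) = inj₁ (inj₁ (x≡h , y≡b))
  swapPairs (inj₂ (inj₁ (y≡h , x≡a))) = inj₂ (inj₂ (x≡a , y≡h))
  swapPairs (inj₂ (inj₂ (y≡a , x≡h))) = inj₂ (inj₁ (x≡h , y≡a))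

  hubFibre : ∀ {x y} → G₁.glue x ≡ G₁.glue h → G₁.glue y ≡ G₁.glue b →
             IsPair x y h b ⊎ IsPair x y h a
  hubFibre {x} xh yb = hubPair (G₁.glue-injectiveAt h≢b h≢a x xh) (G₁.glue-fibreOf-i yb)

  collapse-fibre : ∀ {x y} → collapse x ≡ collapse y →
                   x ≡ y ⊎ IsPair x y b a ⊎ IsPair x y h b ⊎ IsPair x y h a
  collapse-fibre e with G₂.glue-fibre e
  ... | inj₁ e₁ = map₂ inj₁ (G₁.glue-fibre e₁)
  ... | inj₂ (inj₁ (xh , yb)) = inj₂ (inj₂ (hubFibre xh yb))
  ... | inj₂ (inj₂ (xb , yh)) = inj₂ (inj₂ (swapPairs (hubFibre yh xb)))

  collapse-alone : ∀ {w} → w ≢ h → w ≢ b → w ≢ a → Alone collapse w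
  collapse-alone w≢h w≢b w≢a v e with collapse-fibre e
  ... | inj₁ v≡w               = v≡w
  ... | inj₂ (inj₁ ba)        = ⊥-elim (outsidePair w≢b w≢a ba)
  ... | inj₂ (inj₂ (inj₁ hb)) = ⊥-elim (outsidePair w≢h w≢b hb)
  ... | inj₂ (inj₂ (inj₂ ha)) = ⊥-elim (outsidePair w≢h w≢a ha)

module _ {k : ℕ} (G : Graph (suc (suc (suc k)))) where

  twoEdgesPartition : ∀ {p q r s w} → r ≢ p → r ≢ q → s ≢ p → s ≢ q → w ≢ q → w ≢ s →
                      Hinge G p q w → Hinge G r s w → PdsAtMost G (suc k)
  twoEdgesPartition {p} {q} {r} {s} {w} r≢p r≢q s≢p s≢q w≢q w≢s
                    hpq@(pq , pw , _) hrs@(rs , rw , _) =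
    suc k , ≤-refl , collapse , hingePartition G collapse collapse-surjective hinges
    where
    open TwoPairs p q r s (adjacent-distinct G pq) (adjacent-distinct G rs) r≢p r≢q s≢p s≢q

    alone : Alone collapse w
    alone = collapse-alone (adjacent-distinct G pw ∘ sym) w≢q (adjacent-distinct G rw ∘ sym) w≢s

    hinges : ∀ x y → x ≢ y → collapse x ≡ collapse y →
             Σ (Fin (suc (suc (suc k)))) λ w → Alone collapse w × (Hinge G x y w ⊎ Hinge G y x w)
    hinges x y x≢y e with collapse-fibre e
    ... | inj₁ x≡y         = ⊥-elim (x≢y x≡y)
    ... | inj₂ (inj₁ pair) = w , alone , orient G pair hpq
    ... | inj₂ (inj₂ pair) = w , alone , orient G pair hrs

  trianglePartition : ∀ {h b a t u} → t ≢ a → u ≢ b → u ≢ a →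
                      Hinge G b a t → Hinge G h a t → Hinge G h b u → PdsAtMost G (suc k)
  trianglePartition {h} {b} {a} {t} {u} t≢a u≢b u≢a
                    hba@(ba , bt , _) hha@(ha , ht , _) hhb@(hb , hu , _) =
    suc k , ≤-refl , collapse , hingePartition G collapse collapse-surjective hinges
    where
    open Triple h b a (adjacent-distinct G ba) (adjacent-distinct G hb) (adjacent-distinct G ha)

    aloneT : Alone collapse t
    aloneT = collapse-alone (adjacent-distinct G ht ∘ sym) (adjacent-distinct G bt ∘ sym) t≢a

    aloneU : Alone collapse u
    aloneU = collapse-alone (adjacent-distinct G hu ∘ sym) u≢b u≢a

    hinges : ∀ x y → x ≢ y → collapse x ≡ collapse y →
             Σ (Fin (suc (suc (suc k)))) λ w → Alone collapse w × (Hinge G x y w ⊎ Hinge G y x w)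
    hinges x y x≢y e with collapse-fibre e
    ... | inj₁ x≡y                = ⊥-elim (x≢y x≡y)
    ... | inj₂ (inj₁ pair)        = t , aloneT , orient G pair hba
    ... | inj₂ (inj₂ (inj₁ pair)) = u , aloneU , orient G pair hhb
    ... | inj₂ (inj₂ (inj₂ pair)) = t , aloneT , orient G pair hha

inducedCopy-order : ∀ {n m} (G : Graph n) (H : Fin m → Fin m → Bool) →
                    HasInducedCopy G H → m ≤ n
inducedCopy-order G H (f , injective , _) = injective⇒≤ injective

module _ {k : ℕ} (G : Graph (suc (suc (suc k)))) where

  -- C₅ = 0-1-2-3-4-0: edges 01 and 32, with 4 adjacent to 0 and 3 only.
  c5Partition : HasInducedCopy G C5 → PdsAtMost G (suc k)
  c5Partition (f , injective , edge) =
    twoEdgesPartition G (distinct λ ()) (distinct λ ()) (distinct λ ())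
                        (distinct λ ()) (distinct λ ()) (distinct λ ())
      (edge (# 0) (# 1) , edge (# 0) (# 4) , edge (# 1) (# 4))
      (edge (# 3) (# 2) , edge (# 3) (# 4) , edge (# 2) (# 4))
    where
    distinct : ∀ {i j} → i ≢ j → f i ≢ f j
    distinct i≢j = i≢j ∘ injective

  -- S₂,₃ with x = 0, z = 1, yᵢ = 2,3,4: edges x y₂ and z y₃, with y₁
  -- adjacent to x and z only.
  s23Partition : HasInducedCopy G S23 → PdsAtMost G (suc k)
  s23Partition (f , injective , edge) =
    twoEdgesPartition G (distinct λ ()) (distinct λ ()) (distinct λ ())
                        (distinct λ ()) (distinct λ ()) (distinct λ ())
      (edge (# 0) (# 3) , edge (# 0) (# 2) , edge (# 3) (# 2))
      (edge (# 1) (# 4) , edge (# 1) (# 2) , edge (# 4) (# 2))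
    where
    distinct : ∀ {i j} → i ≢ j → f i ≢ f j
    distinct i≢j = i≢j ∘ injective

  -- K₁+C₄ with hub 0 and rim 1-2-3-4-1: the triangle 0,2,1 with t = 3, u = 4.
  wheelPartition : HasInducedCopy G K1+C4 → PdsAtMost G (suc k)
  wheelPartition (f , injective , edge) =
    trianglePartition G (distinct λ ()) (distinct λ ()) (distinct λ ())
      (edge (# 2) (# 1) , edge (# 2) (# 3) , edge (# 1) (# 3))
      (edge (# 0) (# 1) , edge (# 0) (# 3) , edge (# 1) (# 3))
      (edge (# 0) (# 2) , edge (# 0) (# 4) , edge (# 2) (# 4))
    where
    distinct : ∀ {i j} → i ≢ j → f i ≢ f j
    distinct i≢j = i≢j ∘ injective

HasListedCopy : ∀ {n} → Graph n → Set
HasListedCopy G = HasInducedCopy G C5 ⊎ HasInducedCopy G S23 ⊎ HasInducedCopy G K1+C4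

listedCopy-order : ∀ {n} (G : Graph n) → HasListedCopy G → 5 ≤ n
listedCopy-order G (inj₁ c5)           = inducedCopy-order G C5 c5
listedCopy-order G (inj₂ (inj₁ s23))   = inducedCopy-order G S23 s23
listedCopy-order G (inj₂ (inj₂ wheel)) = inducedCopy-order G K1+C4 wheel

listedCopy-partition : ∀ {k} (G : Graph (suc (suc (suc k)))) →
                          HasListedCopy G → PdsAtMost G (suc k)
listedCopy-partition G (inj₁ c5)           = c5Partition G c5
listedCopy-partition G (inj₂ (inj₁ s23))   = s23Partition G s23
listedCopy-partition G (inj₂ (inj₂ wheel)) = wheelPartition G wheel

mainTheorem12 : (n : ℕ) (G : Graph n) → Connected G →
    (HasInducedCopy G C5 ⊎ HasInducedCopy G S23 ⊎ HasInducedCopy G K1+C4) →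
    PdsAtMost G (n ∸ 2)
mainTheorem12 n G _ copy with listedCopy-order G copy
... | s≤s (s≤s (s≤s _)) = listedCopy-partition G copy
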